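{- Let $n \ge 1$ and let $e_1,\dots,e_n$ be positive integers. Then $(x-1)^n$ divides $F = \prod_{k=1}^n (x^{e_k}-1)$, and the cofactor $F/(x-1)^n = \prod_{k=1}^n \frac{x^{e_k}-1}{x-1}$ has height at least $\dfrac{\prod_{j=1}^n e_j}{1+\sum_{j=1}^n (e_j-1)}$. Moreover, for the choice $e_k = 2^{k-1}$, the polynomial $F$ has height $1$ (and degree $2^n-1$).
   Context: The height of $h=\sum c_i x^i\in\mathbb{Z}[x]$ is $\max_i |c_i|$. -}

module Defs where

open import Data.Nat as ℕ using (ℕ; zero; suc)
open import Data.Integer as ℤ using (ℤ; +_; -[1+_]; ∣_∣)
open import Data.List using (List; []; _∷_; map; foldr; replicate; _++_)
open import Data.Fin using (Fin; zero; suc)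
open import Relation.Binary.PropositionalEquality using (_≡_)
open import Relation.Nullary using (¬_)

-- Polynomials in ℤ[x] as little-endian coefficient lists:
-- [c₀ , c₁ , … , c_d] represents c₀ + c₁ x + … + c_d x^d.
Poly : Set
Poly = List ℤ

coeff : Poly → ℕ → ℤ
coeff []       _       = + 0
coeff (c ∷ p)  zero    = c
coeff (c ∷ p)  (suc i) = coeff p i

-- equality of polynomials: all coefficients agree (trailing zeros irrelevant)
_≈ₚ_ : Poly → Poly → Set
p ≈ₚ q = ∀ i → coeff p i ≡ coeff q i

infixl 6 _+ₚ_
infixl 7 _*ₚ_ _·ₚ_

_+ₚ_ : Poly → Poly → Poly
[]      +ₚ q       = q
p       +ₚ []      = p
(a ∷ p) +ₚ (b ∷ q) = (a ℤ.+ b) ∷ (p +ₚ q)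

_·ₚ_ : ℤ → Poly → Poly
c ·ₚ p = map (c ℤ.*_) p

_*ₚ_ : Poly → Poly → Poly
[]      *ₚ q = []
(a ∷ p) *ₚ q = (a ·ₚ q) +ₚ (+ 0 ∷ (p *ₚ q))

-ₚ_ : Poly → Poly
-ₚ p = map ℤ.-_ p

_-ₚ_ : Poly → Poly → Poly
p -ₚ q = p +ₚ (-ₚ q)

oneₚ : Poly
oneₚ = + 1 ∷ []

xᵖ : ℕ → Poly
xᵖ e = replicate e (+ 0) ++ (+ 1 ∷ [])

_^ₚ_ : Poly → ℕ → Poly
p ^ₚ zero  = oneₚ
p ^ₚ suc n = p *ₚ (p ^ₚ n)

∏ₚ : (n : ℕ) → (Fin n → Poly) → Poly
∏ₚ zero    f = oneₚ
∏ₚ (suc n) f = f zero *ₚ ∏ₚ n (λ k → f (suc k))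

-- (x^e - 1)/(x - 1) = 1 + x + … + x^(e-1)
geomₚ : ℕ → Poly
geomₚ e = replicate e (+ 1)

height : Poly → ℕ
height p = foldr ℕ._⊔_ 0 (map ∣_∣ p)

HasDegree : Poly → ℕ → Set
HasDegree p d = (¬ coeff p d ≡ + 0) × (∀ i → d ℕ.< i → coeff p i ≡ + 0)
  where open import Data.Product using (_×_)

∑ : (n : ℕ) → (Fin n → ℕ) → ℕ
∑ zero    f = 0
∑ (suc n) f = f zero ℕ.+ ∑ n (λ k → f (suc k))

∏ : (n : ℕ) → (Fin n → ℕ) → ℕ
∏ zero    f = 1
∏ (suc n) f = f zero ℕ.* ∏ n (λ k → f (suc k))

Fpoly : (n : ℕ) → (Fin n → ℕ) → Poly
Fpoly n e = ∏ₚ n (λ k → xᵖ (e k) -ₚ oneₚ)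

Gpoly : (n : ℕ) → (Fin n → ℕ) → Poly
Gpoly n e = ∏ₚ n (λ k → geomₚ (e k))

xm1 : Poly
xm1 = xᵖ 1 -ₚ oneₚ

module Submission where

-- (1) Factorisation.  x^e − 1 = (x − 1)(1 + … + x^{e−1}) by telescoping, so
--     F = (x − 1)ⁿ G once ℤ[x] is known to be commutative and associative.
-- (2) Height bound.  Evaluation at 1 is multiplicative, so G(1) = ∏ eₖ.  As
--     G(1) is a sum of (length G) coefficients, G(1) ≤ length G · height G,
--     and length G ≤ 1 + ∑ (eₖ − 1) because lengths add (minus one) under
--     multiplication.
-- (3) The case eₖ = 2^{k−1}.  With the dilation p(x) ↦ p(x²), a ring
--     endomorphism of ℤ[x], one has F₍ₙ₊₁₎ = (x − 1) · Fₙ(x²).  The j-th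
--     coefficient of (x − 1) p(x²) is ± the ⌊j/2⌋-th coefficient of p, so
--     "coefficients ±1 below N and 0 from N on" passes from Fₙ with N = 2ⁿ to
--     F₍ₙ₊₁₎ with N = 2ⁿ⁺¹; this yields height 1 and degree 2ⁿ − 1.

open import Defs
open import Data.Nat using (ℕ; _≤_; _*_; _+_; _∸_; _^_)
open import Data.Fin using (Fin; toℕ)
open import Data.Product using (_×_; ∃-syntax)
open import Relation.Binary.PropositionalEquality using (_≡_)

open import Level using (0ℓ)
open import Data.Nat as ℕ using (zero; suc; _<_; s≤s; z≤n; _⊔_; ⌊_/2⌋; ⌈_/2⌉)
import Data.Nat.Properties as ℕP
open import Data.Integer using (ℤ; +_; -[1+_]; ∣_∣)
  renaming (_+_ to _+ᶻ_; _*_ to _*ᶻ_; -_ to -ᶻ_)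
import Data.Integer.Properties as ℤP
open import Data.Integer.Tactic.RingSolver using (solve-∀)
open import Data.List using ([]; _∷_; foldr; length)
import Data.List.Properties as ListP
open import Data.Fin using (zero; suc)
open import Data.Product using (_,_)
open import Relation.Nullary using (¬_; yes; no)
open import Relation.Binary.Bundles using (Setoid)
import Relation.Binary.Reasoning.Setoid as SetoidReasoning
open import Relation.Binary.PropositionalEquality
  using (refl; sym; trans; cong; cong₂; subst; module ≡-Reasoning)

-- Coefficientwise equality, wrapped in a record so that both polynomials
-- can be inferred from a proof; it forms a setoid on Poly.
record _≋_ (p q : Poly) : Set where
  constructor mk
  field at : ∀ i → coeff p i ≡ coeff q i
open _≋_
infix 4 _≋_

≋-setoid : Setoid 0ℓ 0ℓ
≋-setoid = record
  { Carrier       = Poly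
  ; _≈_           = _≋_
  ; isEquivalence = record
    { refl  = mk λ _ → refl
    ; sym   = λ p≋q → mk λ i → sym (at p≋q i)
    ; trans = λ p≋q q≋r → mk λ i → trans (at p≋q i) (at q≋r i)
    }
  }

open Setoid ≋-setoid using ()
  renaming (refl to ≋-refl; sym to ≋-sym; trans to ≋-trans)
module ≋-Reasoning = SetoidReasoning ≋-setoid

∷-cong : ∀ {a b p q} → a ≡ b → p ≋ q → a ∷ p ≋ b ∷ q
∷-cong a≡b p≋q = mk λ { zero → a≡b ; (suc i) → at p≋q i }

coeff-+ : ∀ p q i → coeff (p +ₚ q) i ≡ coeff p i +ᶻ coeff q i
coeff-+ []      q       i       = sym (ℤP.+-identityˡ _)
coeff-+ (a ∷ p) []      i       = sym (ℤP.+-identityʳ _)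
coeff-+ (a ∷ p) (b ∷ q) zero    = refl
coeff-+ (a ∷ p) (b ∷ q) (suc i) = coeff-+ p q i

coeff-· : ∀ c p i → coeff (c ·ₚ p) i ≡ c *ᶻ coeff p i
coeff-· c []      i       = sym (ℤP.*-zeroʳ c)
coeff-· c (a ∷ p) zero    = refl
coeff-· c (a ∷ p) (suc i) = coeff-· c p i

coeff-∷* : ∀ a p q i →
  coeff ((a ∷ p) *ₚ q) i ≡ a *ᶻ coeff q i +ᶻ coeff (+ 0 ∷ (p *ₚ q)) i
coeff-∷* a p q i =
  trans (coeff-+ (a ·ₚ q) (+ 0 ∷ (p *ₚ q)) i) (cong (_+ᶻ _) (coeff-· a q i))

0∷-* : ∀ p q → (+ 0 ∷ p) *ₚ q ≋ + 0 ∷ (p *ₚ q)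
0∷-* p q = mk λ i → trans (coeff-∷* (+ 0) p q i) (ℤP.+-identityˡ _)

+-cong : ∀ {p p′ q q′} → p ≋ p′ → q ≋ q′ → p +ₚ q ≋ p′ +ₚ q′
+-cong {p} {p′} {q} {q′} p≋p′ q≋q′ = mk λ i → begin
  coeff (p +ₚ q) i           ≡⟨ coeff-+ p q i ⟩
  coeff p i +ᶻ coeff q i     ≡⟨ cong₂ _+ᶻ_ (at p≋p′ i) (at q≋q′ i) ⟩
  coeff p′ i +ᶻ coeff q′ i   ≡⟨ coeff-+ p′ q′ i ⟨
  coeff (p′ +ₚ q′) i         ∎
  where open ≡-Reasoning

*-zeroˡ : ∀ p q → p ≋ [] → p *ₚ q ≋ []
*-zeroˡ []      q p≋0 = ≋-refl
*-zeroˡ (a ∷ p) q p≋0 = mk λ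
  { zero    → trans (coeff-∷* a p q 0) (cong (λ z → z *ᶻ coeff q 0 +ᶻ + 0) (at p≋0 0))
  ; (suc i) → trans (coeff-∷* a p q (suc i))
      (cong₂ (λ z w → z *ᶻ coeff q (suc i) +ᶻ w) (at p≋0 0) (at (*-zeroˡ p q (mk λ j → at p≋0 (suc j))) i))
  }

*-congˡ : ∀ {p p′} q → p ≋ p′ → p *ₚ q ≋ p′ *ₚ q
*-congˡ {[]}    {p′}     q p≋p′ = ≋-sym (*-zeroˡ p′ q (≋-sym p≋p′))
*-congˡ {a ∷ p} {[]}     q p≋p′ = *-zeroˡ (a ∷ p) q p≋p′
*-congˡ {a ∷ p} {a′ ∷ p′} q p≋p′ = mk λ i → begin
  coeff ((a ∷ p) *ₚ q) i                           ≡⟨ coeff-∷* a p q i ⟩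
  a *ᶻ coeff q i +ᶻ coeff (+ 0 ∷ (p *ₚ q)) i       ≡⟨ cong₂ (λ z w → z *ᶻ coeff q i +ᶻ w) (at p≋p′ 0) (at tails i) ⟩
  a′ *ᶻ coeff q i +ᶻ coeff (+ 0 ∷ (p′ *ₚ q)) i     ≡⟨ coeff-∷* a′ p′ q i ⟨
  coeff ((a′ ∷ p′) *ₚ q) i                         ∎
  where
  open ≡-Reasoning
  tails : + 0 ∷ (p *ₚ q) ≋ + 0 ∷ (p′ *ₚ q)
  tails = ∷-cong refl (*-congˡ {p} {p′} q (mk λ j → at p≋p′ (suc j)))

*-congʳ : ∀ p {q q′} → q ≋ q′ → p *ₚ q ≋ p *ₚ q′
*-congʳ []      q≋q′ = ≋-refl
*-congʳ (a ∷ p) {q} {q′} q≋q′ = mk λ i → begin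
  coeff ((a ∷ p) *ₚ q) i                           ≡⟨ coeff-∷* a p q i ⟩
  a *ᶻ coeff q i +ᶻ coeff (+ 0 ∷ (p *ₚ q)) i       ≡⟨ cong₂ (λ z w → a *ᶻ z +ᶻ w) (at q≋q′ i) (at (∷-cong refl (*-congʳ p q≋q′)) i) ⟩
  a *ᶻ coeff q′ i +ᶻ coeff (+ 0 ∷ (p *ₚ q′)) i     ≡⟨ coeff-∷* a p q′ i ⟨
  coeff ((a ∷ p) *ₚ q′) i                          ∎
  where open ≡-Reasoning

*-cong : ∀ {p p′ q q′} → p ≋ p′ → q ≋ q′ → p *ₚ q ≋ p′ *ₚ q′
*-cong {p′ = p′} {q = q} p≋p′ q≋q′ = ≋-trans (*-congˡ q p≋p′) (*-congʳ p′ q≋q′)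

-- Commutativity of ℤ[x].  The product is defined by recursion on its left
-- factor, so we first expand a product whose RIGHT factor is a cons-cell:
-- q (a + x p) = a q + x (q p).
*-zeroʳ : ∀ p → p *ₚ [] ≋ []
*-zeroʳ []      = ≋-refl
*-zeroʳ (a ∷ p) = mk λ { zero → refl ; (suc i) → at (*-zeroʳ p) i }

*-∷ʳ : ∀ q a p → q *ₚ (a ∷ p) ≋ (a ·ₚ q) +ₚ (+ 0 ∷ (q *ₚ p))
*-∷ʳ []      a p = mk λ { zero → refl ; (suc i) → refl }
*-∷ʳ (b ∷ q) a p = ∷-cong (cong (_+ᶻ + 0) (ℤP.*-comm b a)) (mk tail)
  where
  open ≡-Reasoning
  exchange : ∀ x y z → x +ᶻ (y +ᶻ z) ≡ y +ᶻ (x +ᶻ z)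
  exchange = solve-∀
  tail : ∀ i → coeff ((b ·ₚ p) +ₚ (q *ₚ (a ∷ p))) i
             ≡ coeff ((a ·ₚ q) +ₚ ((b ·ₚ p) +ₚ (+ 0 ∷ (q *ₚ p)))) i
  tail i = begin
    coeff ((b ·ₚ p) +ₚ (q *ₚ (a ∷ p))) i
      ≡⟨ trans (coeff-+ (b ·ₚ p) _ i) (cong₂ _+ᶻ_ (coeff-· b p i) (at (*-∷ʳ q a p) i)) ⟩
    b *ᶻ coeff p i +ᶻ coeff ((a ·ₚ q) +ₚ (+ 0 ∷ (q *ₚ p))) i
      ≡⟨ cong (b *ᶻ coeff p i +ᶻ_) (trans (coeff-+ (a ·ₚ q) _ i) (cong (_+ᶻ _) (coeff-· a q i))) ⟩
    b *ᶻ coeff p i +ᶻ (a *ᶻ coeff q i +ᶻ coeff (+ 0 ∷ (q *ₚ p)) i)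
      ≡⟨ exchange (b *ᶻ coeff p i) (a *ᶻ coeff q i) _ ⟩
    a *ᶻ coeff q i +ᶻ (b *ᶻ coeff p i +ᶻ coeff (+ 0 ∷ (q *ₚ p)) i)
      ≡⟨ cong₂ _+ᶻ_ (coeff-· a q i) (coeff-∷* b q p i) ⟨
    coeff (a ·ₚ q) i +ᶻ coeff ((b ∷ q) *ₚ p) i
      ≡⟨ coeff-+ (a ·ₚ q) _ i ⟨
    coeff ((a ·ₚ q) +ₚ ((b ·ₚ p) +ₚ (+ 0 ∷ (q *ₚ p)))) i
      ∎

*-comm : ∀ p q → p *ₚ q ≋ q *ₚ p
*-comm []      q = ≋-sym (*-zeroʳ q)
*-comm (a ∷ p) q = ≋-trans (+-cong {a ·ₚ q} ≋-refl (∷-cong refl (*-comm p q))) (≋-sym (*-∷ʳ q a p))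

*-distribʳ-+ : ∀ s t r → (s +ₚ t) *ₚ r ≋ (s *ₚ r) +ₚ (t *ₚ r)
*-distribʳ-+ []      t       r = ≋-refl
*-distribʳ-+ (a ∷ s) []      r = mk λ i → sym (trans (coeff-+ ((a ∷ s) *ₚ r) [] i) (ℤP.+-identityʳ _))
*-distribʳ-+ (a ∷ s) (b ∷ t) r = mk λ i →
  let S = coeff (+ 0 ∷ (s *ₚ r)) i ; T = coeff (+ 0 ∷ (t *ₚ r)) i ; rᵢ = coeff r i in begin
  coeff (((a ∷ s) +ₚ (b ∷ t)) *ₚ r) i
    ≡⟨ coeff-∷* (a +ᶻ b) (s +ₚ t) r i ⟩
  (a +ᶻ b) *ᶻ rᵢ +ᶻ coeff (+ 0 ∷ ((s +ₚ t) *ₚ r)) i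
    ≡⟨ cong ((a +ᶻ b) *ᶻ rᵢ +ᶻ_) (trans (at (∷-cong refl (*-distribʳ-+ s t r)) i) (coeff-+ (+ 0 ∷ (s *ₚ r)) (+ 0 ∷ (t *ₚ r)) i)) ⟩
  (a +ᶻ b) *ᶻ rᵢ +ᶻ (S +ᶻ T)
    ≡⟨ regroup a b rᵢ S T ⟩
  (a *ᶻ rᵢ +ᶻ S) +ᶻ (b *ᶻ rᵢ +ᶻ T)
    ≡⟨ cong₂ _+ᶻ_ (coeff-∷* a s r i) (coeff-∷* b t r i) ⟨
  coeff ((a ∷ s) *ₚ r) i +ᶻ coeff ((b ∷ t) *ₚ r) i
    ≡⟨ coeff-+ ((a ∷ s) *ₚ r) _ i ⟨
  coeff (((a ∷ s) *ₚ r) +ₚ ((b ∷ t) *ₚ r)) i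
    ∎
  where
  open ≡-Reasoning
  regroup : ∀ a b x y z → (a +ᶻ b) *ᶻ x +ᶻ (y +ᶻ z) ≡ (a *ᶻ x +ᶻ y) +ᶻ (b *ᶻ x +ᶻ z)
  regroup = solve-∀

·-*-assoc : ∀ c q r → (c ·ₚ q) *ₚ r ≋ c ·ₚ (q *ₚ r)
·-*-assoc c []      r = ≋-refl
·-*-assoc c (b ∷ q) r = mk λ i →
  let Q = coeff (+ 0 ∷ (q *ₚ r)) i ; rᵢ = coeff r i in begin
  coeff ((c ·ₚ (b ∷ q)) *ₚ r) i
    ≡⟨ coeff-∷* (c *ᶻ b) (c ·ₚ q) r i ⟩
  c *ᶻ b *ᶻ rᵢ +ᶻ coeff (+ 0 ∷ ((c ·ₚ q) *ₚ r)) i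
    ≡⟨ cong (c *ᶻ b *ᶻ rᵢ +ᶻ_) (trans (at (∷-cong refl (·-*-assoc c q r)) i) (trans (at shift i) (coeff-· c (+ 0 ∷ (q *ₚ r)) i))) ⟩
  c *ᶻ b *ᶻ rᵢ +ᶻ c *ᶻ Q
    ≡⟨ factor c b rᵢ Q ⟩
  c *ᶻ (b *ᶻ rᵢ +ᶻ Q)
    ≡⟨ cong (c *ᶻ_) (coeff-∷* b q r i) ⟨
  c *ᶻ coeff ((b ∷ q) *ₚ r) i
    ≡⟨ coeff-· c ((b ∷ q) *ₚ r) i ⟨
  coeff (c ·ₚ ((b ∷ q) *ₚ r)) i
    ∎
  where
  open ≡-Reasoning
  factor : ∀ c b x y → c *ᶻ b *ᶻ x +ᶻ c *ᶻ y ≡ c *ᶻ (b *ᶻ x +ᶻ y)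
  factor = solve-∀
  shift : + 0 ∷ (c ·ₚ (q *ₚ r)) ≋ c ·ₚ (+ 0 ∷ (q *ₚ r))
  shift = ∷-cong (sym (ℤP.*-zeroʳ c)) ≋-refl

*-assoc : ∀ p q r → (p *ₚ q) *ₚ r ≋ p *ₚ (q *ₚ r)
*-assoc []      q r = ≋-refl
*-assoc (a ∷ p) q r = begin
  ((a ·ₚ q) +ₚ (+ 0 ∷ (p *ₚ q))) *ₚ r          ≈⟨ *-distribʳ-+ (a ·ₚ q) _ r ⟩
  ((a ·ₚ q) *ₚ r) +ₚ ((+ 0 ∷ (p *ₚ q)) *ₚ r)   ≈⟨ +-cong (·-*-assoc a q r) (0∷-* (p *ₚ q) r) ⟩
  (a ·ₚ (q *ₚ r)) +ₚ (+ 0 ∷ ((p *ₚ q) *ₚ r))   ≈⟨ +-cong {a ·ₚ (q *ₚ r)} ≋-refl (∷-cong refl (*-assoc p q r)) ⟩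
  (a ·ₚ (q *ₚ r)) +ₚ (+ 0 ∷ (p *ₚ (q *ₚ r)))   ∎
  where open ≋-Reasoning

*-interchange : ∀ a b c d → (a *ₚ b) *ₚ (c *ₚ d) ≋ (a *ₚ c) *ₚ (b *ₚ d)
*-interchange a b c d = begin
  (a *ₚ b) *ₚ (c *ₚ d)   ≈⟨ *-assoc a b (c *ₚ d) ⟩
  a *ₚ (b *ₚ (c *ₚ d))   ≈⟨ *-congʳ a (≋-sym (*-assoc b c d)) ⟩
  a *ₚ ((b *ₚ c) *ₚ d)   ≈⟨ *-congʳ a (*-congˡ d (*-comm b c)) ⟩
  a *ₚ ((c *ₚ b) *ₚ d)   ≈⟨ *-congʳ a (*-assoc c b d) ⟩
  a *ₚ (c *ₚ (b *ₚ d))   ≈⟨ *-assoc a c (b *ₚ d) ⟨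
  (a *ₚ c) *ₚ (b *ₚ d)   ∎
  where open ≋-Reasoning

coeff-xm1*-zero : ∀ g → coeff (xm1 *ₚ g) 0 ≡ -ᶻ coeff g 0
coeff-xm1*-zero g = trans (coeff-∷* -[1+ 0 ] (+ 1 ∷ []) g 0) (negate (coeff g 0))
  where
  negate : ∀ x → -ᶻ + 1 *ᶻ x +ᶻ + 0 ≡ -ᶻ x
  negate = solve-∀

coeff-xm1*-suc : ∀ g i → coeff (xm1 *ₚ g) (suc i) ≡ coeff g i +ᶻ -ᶻ coeff g (suc i)
coeff-xm1*-suc g i = begin
  coeff (xm1 *ₚ g) (suc i)
    ≡⟨ coeff-∷* -[1+ 0 ] (+ 1 ∷ []) g (suc i) ⟩
  -[1+ 0 ] *ᶻ coeff g (suc i) +ᶻ coeff ((+ 1 ∷ []) *ₚ g) i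
    ≡⟨ cong (-[1+ 0 ] *ᶻ coeff g (suc i) +ᶻ_) (trans (coeff-∷* (+ 1) [] g i) (cong (+ 1 *ᶻ coeff g i +ᶻ_) (zeros i))) ⟩
  -ᶻ + 1 *ᶻ coeff g (suc i) +ᶻ (+ 1 *ᶻ coeff g i +ᶻ + 0)
    ≡⟨ difference (coeff g i) (coeff g (suc i)) ⟩
  coeff g i +ᶻ -ᶻ coeff g (suc i)
    ∎
  where
  open ≡-Reasoning
  zeros : ∀ i → coeff (+ 0 ∷ []) i ≡ + 0
  zeros zero    = refl
  zeros (suc i) = refl
  difference : ∀ x y → -ᶻ + 1 *ᶻ y +ᶻ (+ 1 *ᶻ x +ᶻ + 0) ≡ x +ᶻ -ᶻ y
  difference = solve-∀

-- Telescoping: x^e − 1 = (x − 1)(1 + x + … + x^{e−1}).  Coefficientwise this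
-- says that x^e has coefficient 1 exactly where geomₚ e stops.
coeff-xᵖ-telescopes : ∀ e j → coeff (xᵖ e) (suc j) ≡ coeff (geomₚ e) j +ᶻ -ᶻ coeff (geomₚ e) (suc j)
coeff-xᵖ-telescopes zero          j       = refl
coeff-xᵖ-telescopes (suc zero)    zero    = refl
coeff-xᵖ-telescopes (suc (suc e)) zero    = refl
coeff-xᵖ-telescopes (suc e)       (suc j) = coeff-xᵖ-telescopes e j

xᵖ-1≋xm1*geom : ∀ e → xᵖ e -ₚ oneₚ ≋ xm1 *ₚ geomₚ e
xᵖ-1≋xm1*geom e = mk (coeffs e)
  where
  coeffs : ∀ e i → coeff (xᵖ e -ₚ oneₚ) i ≡ coeff (xm1 *ₚ geomₚ e) i
  coeffs zero    zero    = refl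
  coeffs (suc e) zero    = refl
  coeffs e       (suc i) = begin
    coeff (xᵖ e -ₚ oneₚ) (suc i)                              ≡⟨ coeff-+ (xᵖ e) (-ₚ oneₚ) (suc i) ⟩
    coeff (xᵖ e) (suc i) +ᶻ + 0                               ≡⟨ ℤP.+-identityʳ _ ⟩
    coeff (xᵖ e) (suc i)                                      ≡⟨ coeff-xᵖ-telescopes e i ⟩
    coeff (geomₚ e) i +ᶻ -ᶻ coeff (geomₚ e) (suc i)           ≡⟨ coeff-xm1*-suc (geomₚ e) i ⟨
    coeff (xm1 *ₚ geomₚ e) (suc i)                            ∎
    where open ≡-Reasoning

F≋xm1^n*G : ∀ n e → Fpoly n e ≋ (xm1 ^ₚ n) *ₚ Gpoly n e
F≋xm1^n*G zero    e = mk λ { zero → refl ; (suc zero) → refl ; (suc (suc i)) → refl }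
F≋xm1^n*G (suc n) e = begin
  (xᵖ (e zero) -ₚ oneₚ) *ₚ Fpoly n e′                ≈⟨ *-cong (xᵖ-1≋xm1*geom (e zero)) (F≋xm1^n*G n e′) ⟩
  (xm1 *ₚ geomₚ (e zero)) *ₚ ((xm1 ^ₚ n) *ₚ Gpoly n e′) ≈⟨ *-interchange xm1 (geomₚ (e zero)) (xm1 ^ₚ n) (Gpoly n e′) ⟩
  (xm1 *ₚ (xm1 ^ₚ n)) *ₚ (geomₚ (e zero) *ₚ Gpoly n e′) ∎
  where
  open ≋-Reasoning
  e′ : Fin n → ℕ
  e′ k = e (suc k)

eval₁ : Poly → ℤ
eval₁ = foldr _+ᶻ_ (+ 0)

eval₁-+ : ∀ p q → eval₁ (p +ₚ q) ≡ eval₁ p +ᶻ eval₁ q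
eval₁-+ []      q       = sym (ℤP.+-identityˡ _)
eval₁-+ (a ∷ p) []      = sym (ℤP.+-identityʳ _)
eval₁-+ (a ∷ p) (b ∷ q) = trans (cong ((a +ᶻ b) +ᶻ_) (eval₁-+ p q)) (regroup a b (eval₁ p) (eval₁ q))
  where
  regroup : ∀ a b x y → (a +ᶻ b) +ᶻ (x +ᶻ y) ≡ (a +ᶻ x) +ᶻ (b +ᶻ y)
  regroup = solve-∀

eval₁-· : ∀ c p → eval₁ (c ·ₚ p) ≡ c *ᶻ eval₁ p
eval₁-· c []      = sym (ℤP.*-zeroʳ c)
eval₁-· c (a ∷ p) = trans (cong (c *ᶻ a +ᶻ_) (eval₁-· c p)) (sym (ℤP.*-distribˡ-+ c a (eval₁ p)))

eval₁-* : ∀ p q → eval₁ (p *ₚ q) ≡ eval₁ p *ᶻ eval₁ q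
eval₁-* []      q = refl
eval₁-* (a ∷ p) q = begin
  eval₁ ((a ·ₚ q) +ₚ (+ 0 ∷ (p *ₚ q)))          ≡⟨ eval₁-+ (a ·ₚ q) (+ 0 ∷ (p *ₚ q)) ⟩
  eval₁ (a ·ₚ q) +ᶻ (+ 0 +ᶻ eval₁ (p *ₚ q))     ≡⟨ cong₂ (λ u v → u +ᶻ (+ 0 +ᶻ v)) (eval₁-· a q) (eval₁-* p q) ⟩
  a *ᶻ eval₁ q +ᶻ (+ 0 +ᶻ eval₁ p *ᶻ eval₁ q)   ≡⟨ collect a (eval₁ p) (eval₁ q) ⟩
  (a +ᶻ eval₁ p) *ᶻ eval₁ q                     ∎
  where
  open ≡-Reasoning
  collect : ∀ a x y → a *ᶻ y +ᶻ (+ 0 +ᶻ x *ᶻ y) ≡ (a +ᶻ x) *ᶻ y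
  collect = solve-∀

eval₁-geom : ∀ e → eval₁ (geomₚ e) ≡ + e
eval₁-geom zero    = refl
eval₁-geom (suc e) = cong (+ 1 +ᶻ_) (eval₁-geom e)

eval₁-G : ∀ n e → eval₁ (Gpoly n e) ≡ + ∏ n e
eval₁-G zero    e = refl
eval₁-G (suc n) e = begin
  eval₁ (geomₚ (e zero) *ₚ Gpoly n e′)              ≡⟨ eval₁-* (geomₚ (e zero)) (Gpoly n e′) ⟩
  eval₁ (geomₚ (e zero)) *ᶻ eval₁ (Gpoly n e′)      ≡⟨ cong₂ _*ᶻ_ (eval₁-geom (e zero)) (eval₁-G n e′) ⟩
  + e zero *ᶻ + ∏ n e′                              ≡⟨ ℤP.pos-* (e zero) (∏ n e′) ⟨
  + (e zero * ∏ n e′)                               ∎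
  where
  open ≡-Reasoning
  e′ : Fin n → ℕ
  e′ k = e (suc k)

∣eval₁∣≤length*height : ∀ p → ∣ eval₁ p ∣ ≤ length p * height p
∣eval₁∣≤length*height []      = z≤n
∣eval₁∣≤length*height (a ∷ p) = begin
  ∣ a +ᶻ eval₁ p ∣                     ≤⟨ ℤP.∣i+j∣≤∣i∣+∣j∣ a (eval₁ p) ⟩
  ∣ a ∣ + ∣ eval₁ p ∣                  ≤⟨ ℕP.+-monoʳ-≤ ∣ a ∣ (∣eval₁∣≤length*height p) ⟩
  ∣ a ∣ + length p * height p          ≤⟨ ℕP.+-mono-≤ (ℕP.m≤m⊔n ∣ a ∣ h) (ℕP.*-monoʳ-≤ (length p) (ℕP.m≤n⊔m ∣ a ∣ h)) ⟩
  (∣ a ∣ ⊔ h) + length p * (∣ a ∣ ⊔ h) ∎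
  where
  open ℕP.≤-Reasoning
  h : ℕ
  h = height p

length-+ : ∀ p q → length (p +ₚ q) ≡ length p ⊔ length q
length-+ []      q       = refl
length-+ (a ∷ p) []      = refl
length-+ (a ∷ p) (b ∷ q) = cong suc (length-+ p q)

length-* : ∀ p q → length (p *ₚ q) ≤ length p + (length q ∸ 1)
length-* []      q = z≤n
length-* (a ∷ p) q = begin
  length ((a ·ₚ q) +ₚ (+ 0 ∷ (p *ₚ q)))       ≡⟨ length-+ (a ·ₚ q) (+ 0 ∷ (p *ₚ q)) ⟩
  length (a ·ₚ q) ⊔ suc (length (p *ₚ q))     ≡⟨ cong (_⊔ _) (ListP.length-map (a *ᶻ_) q) ⟩
  length q ⊔ suc (length (p *ₚ q))            ≤⟨ ℕP.⊔-lub q-fits (s≤s (length-* p q)) ⟩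
  suc (length p + (length q ∸ 1))             ∎
  where
  open ℕP.≤-Reasoning
  q-fits : length q ≤ suc (length p + (length q ∸ 1))
  q-fits = ℕP.≤-trans (ℕP.m≤n+m∸n (length q) 1) (s≤s (ℕP.m≤n+m (length q ∸ 1) (length p)))

length-G : ∀ n e → (∀ k → 1 ≤ e k) → length (Gpoly n e) ≤ 1 + ∑ n (λ j → e j ∸ 1)
length-G zero    e e≥1 = ℕP.≤-refl
length-G (suc n) e e≥1 = begin
  length (geomₚ (e zero) *ₚ Gpoly n e′)          ≤⟨ length-* (geomₚ (e zero)) (Gpoly n e′) ⟩
  length (geomₚ (e zero)) + (length (Gpoly n e′) ∸ 1)
    ≤⟨ ℕP.+-mono-≤ (ℕP.≤-reflexive (ListP.length-replicate (e zero))) (ℕP.∸-monoˡ-≤ 1 (length-G n e′ (λ k → e≥1 (suc k)))) ⟩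
  e zero + ∑′                                    ≡⟨ cong (_+ ∑′) (ℕP.m+[n∸m]≡n (e≥1 zero)) ⟨
  1 + (e zero ∸ 1) + ∑′                          ∎
  where
  open ℕP.≤-Reasoning
  e′ : Fin n → ℕ
  e′ k = e (suc k)
  ∑′ : ℕ
  ∑′ = ∑ n (λ j → e′ j ∸ 1)

height-G-bound : ∀ n e → (∀ k → 1 ≤ e k) → ∏ n e ≤ height (Gpoly n e) * (1 + ∑ n (λ j → e j ∸ 1))
height-G-bound n e e≥1 = begin
  ∏ n e                                ≡⟨ cong ∣_∣ (eval₁-G n e) ⟨
  ∣ eval₁ G ∣                          ≤⟨ ∣eval₁∣≤length*height G ⟩
  length G * height G                  ≤⟨ ℕP.*-monoˡ-≤ (height G) (length-G n e e≥1) ⟩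
  (1 + ∑ n (λ j → e j ∸ 1)) * height G ≡⟨ ℕP.*-comm (1 + ∑ n (λ j → e j ∸ 1)) (height G) ⟩
  height G * (1 + ∑ n (λ j → e j ∸ 1)) ∎
  where
  open ℕP.≤-Reasoning
  G : Poly
  G = Gpoly n e

-- The dilation p(x) ↦ p(x²) inserts a zero after every coefficient.  It is
-- a ring endomorphism of ℤ[x] and maps x^m − 1 to x^{2m} − 1.
dilate : Poly → Poly
dilate []      = []
dilate (c ∷ p) = c ∷ + 0 ∷ dilate p

dilate-+ : ∀ p q → dilate (p +ₚ q) ≡ dilate p +ₚ dilate q
dilate-+ []      q       = refl
dilate-+ (a ∷ p) []      = refl
dilate-+ (a ∷ p) (b ∷ q) = cong (λ r → (a +ᶻ b) ∷ + 0 ∷ r) (dilate-+ p q)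

dilate-· : ∀ c p → dilate (c ·ₚ p) ≋ c ·ₚ dilate p
dilate-· c []      = ≋-refl
dilate-· c (a ∷ p) = ∷-cong refl (∷-cong (sym (ℤP.*-zeroʳ c)) (dilate-· c p))

dilate-* : ∀ p q → dilate (p *ₚ q) ≋ dilate p *ₚ dilate q
dilate-* []      q = ≋-refl
dilate-* (a ∷ p) q = begin
  dilate ((a ·ₚ q) +ₚ (+ 0 ∷ (p *ₚ q)))              ≡⟨ dilate-+ (a ·ₚ q) (+ 0 ∷ (p *ₚ q)) ⟩
  dilate (a ·ₚ q) +ₚ (+ 0 ∷ + 0 ∷ dilate (p *ₚ q))   ≈⟨ +-cong (dilate-· a q) (∷-cong refl (∷-cong refl (dilate-* p q))) ⟩
  (a ·ₚ dilate q) +ₚ (+ 0 ∷ + 0 ∷ (dilate p *ₚ dilate q))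
    ≈⟨ +-cong {a ·ₚ dilate q} ≋-refl (∷-cong refl (≋-sym (0∷-* (dilate p) (dilate q)))) ⟩
  (a ·ₚ dilate q) +ₚ (+ 0 ∷ ((+ 0 ∷ dilate p) *ₚ dilate q)) ∎
  where open ≋-Reasoning

∏ₚ-cong : ∀ n (f g : Fin n → Poly) → (∀ k → f k ≋ g k) → ∏ₚ n f ≋ ∏ₚ n g
∏ₚ-cong zero    f g f≋g = ≋-refl
∏ₚ-cong (suc n) f g f≋g = *-cong (f≋g zero) (∏ₚ-cong n (λ k → f (suc k)) (λ k → g (suc k)) (λ k → f≋g (suc k)))

dilate-∏ₚ : ∀ n (f : Fin n → Poly) → dilate (∏ₚ n f) ≋ ∏ₚ n (λ k → dilate (f k))
dilate-∏ₚ zero    f = mk λ { zero → refl ; (suc zero) → refl ; (suc (suc i)) → refl }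
dilate-∏ₚ (suc n) f =
  ≋-trans (dilate-* (f zero) (∏ₚ n (λ k → f (suc k))))
          (*-congʳ (dilate (f zero)) (dilate-∏ₚ n (λ k → f (suc k))))

dilate-xᵖ : ∀ m → dilate (xᵖ m) ≋ xᵖ (m + m)
dilate-xᵖ zero    = mk λ { zero → refl ; (suc zero) → refl ; (suc (suc i)) → refl }
dilate-xᵖ (suc m) rewrite ℕP.+-suc m m = ∷-cong refl (∷-cong refl (dilate-xᵖ m))

dilate-xᵖ-1 : ∀ m → xᵖ (2 * m) -ₚ oneₚ ≋ dilate (xᵖ m -ₚ oneₚ)
dilate-xᵖ-1 m = begin
  xᵖ (2 * m) +ₚ (-ₚ oneₚ)             ≡⟨ cong (λ k → xᵖ (m + k) +ₚ (-ₚ oneₚ)) (ℕP.+-identityʳ m) ⟩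
  xᵖ (m + m) +ₚ (-ₚ oneₚ)             ≈⟨ +-cong (≋-sym (dilate-xᵖ m)) (mk λ { zero → refl ; (suc zero) → refl ; (suc (suc i)) → refl }) ⟩
  dilate (xᵖ m) +ₚ dilate (-ₚ oneₚ)   ≡⟨ dilate-+ (xᵖ m) (-ₚ oneₚ) ⟨
  dilate (xᵖ m -ₚ oneₚ)               ∎
  where open ≋-Reasoning

powersOfTwo : (n : ℕ) → Fin n → ℕ
powersOfTwo n k = 2 ^ toℕ k

F-doubling : ∀ n → Fpoly (suc n) (powersOfTwo (suc n)) ≋ xm1 *ₚ dilate (Fpoly n (powersOfTwo n))
F-doubling n = *-congʳ xm1 (begin
  ∏ₚ n (λ k → xᵖ (2 * powersOfTwo n k) -ₚ oneₚ)         ≈⟨ ∏ₚ-cong n _ _ (λ k → dilate-xᵖ-1 (powersOfTwo n k)) ⟩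
  ∏ₚ n (λ k → dilate (xᵖ (powersOfTwo n k) -ₚ oneₚ))    ≈⟨ dilate-∏ₚ n (λ k → xᵖ (powersOfTwo n k) -ₚ oneₚ) ⟨
  dilate (Fpoly n (powersOfTwo n))                      ∎)
  where open ≋-Reasoning

-- Up to sign, the j-th coefficient of (x − 1) p(x²) is the ⌊j/2⌋-th
-- coefficient of p: consecutive coefficients of p(x²) are pᵢ and 0.
coeff-dilate-zero : ∀ p → coeff (dilate p) 0 ≡ coeff p 0
coeff-dilate-zero []      = refl
coeff-dilate-zero (c ∷ p) = refl

∣dilate-difference∣ : ∀ p j →
  ∣ coeff (dilate p) j +ᶻ -ᶻ coeff (dilate p) (suc j) ∣ ≡ ∣ coeff p ⌊ suc j /2⌋ ∣
∣dilate-difference∣ []      j             = refl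
∣dilate-difference∣ (c ∷ p) zero          = cong ∣_∣ (ℤP.+-identityʳ c)
∣dilate-difference∣ (c ∷ p) (suc zero)    = begin
  ∣ + 0 +ᶻ -ᶻ coeff (dilate p) 0 ∣   ≡⟨ cong ∣_∣ (ℤP.+-identityˡ (-ᶻ coeff (dilate p) 0)) ⟩
  ∣ -ᶻ coeff (dilate p) 0 ∣          ≡⟨ ℤP.∣-i∣≡∣i∣ (coeff (dilate p) 0) ⟩
  ∣ coeff (dilate p) 0 ∣             ≡⟨ cong ∣_∣ (coeff-dilate-zero p) ⟩
  ∣ coeff p 0 ∣                      ∎
  where open ≡-Reasoning
∣dilate-difference∣ (c ∷ p) (suc (suc j)) = ∣dilate-difference∣ p j

∣coeff-xm1*dilate∣ : ∀ p j → ∣ coeff (xm1 *ₚ dilate p) j ∣ ≡ ∣ coeff p ⌊ j /2⌋ ∣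
∣coeff-xm1*dilate∣ p zero    = begin
  ∣ coeff (xm1 *ₚ dilate p) 0 ∣    ≡⟨ cong ∣_∣ (coeff-xm1*-zero (dilate p)) ⟩
  ∣ -ᶻ coeff (dilate p) 0 ∣        ≡⟨ ℤP.∣-i∣≡∣i∣ (coeff (dilate p) 0) ⟩
  ∣ coeff (dilate p) 0 ∣           ≡⟨ cong ∣_∣ (coeff-dilate-zero p) ⟩
  ∣ coeff p 0 ∣                    ∎
  where open ≡-Reasoning
∣coeff-xm1*dilate∣ p (suc j) =
  trans (cong ∣_∣ (coeff-xm1*-suc (dilate p) j)) (∣dilate-difference∣ p j)

⌊j/2⌋<N : ∀ {j N} → j < N + N → ⌊ j /2⌋ < N
⌊j/2⌋<N {j} {N} j<2N = ℕP.≰⇒> λ N≤⌊j/2⌋ → ℕP.<⇒≱ j<2N (begin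
  N + N               ≤⟨ ℕP.+-mono-≤ N≤⌊j/2⌋ (ℕP.≤-trans N≤⌊j/2⌋ (ℕP.⌊n/2⌋≤⌈n/2⌉ j)) ⟩
  ⌊ j /2⌋ + ⌈ j /2⌉   ≡⟨ ℕP.⌊n/2⌋+⌈n/2⌉≡n j ⟩
  j                   ∎)
  where open ℕP.≤-Reasoning

N≤⌊j/2⌋ : ∀ {j N} → N + N ≤ j → N ≤ ⌊ j /2⌋
N≤⌊j/2⌋ {j} {N} 2N≤j = subst (_≤ ⌊ j /2⌋) (sym (ℕP.n≡⌊n+n/2⌋ N)) (ℕP.⌊n/2⌋-mono 2N≤j)

UnitCoeffsBelow : Poly → ℕ → Set
UnitCoeffsBelow p N = (∀ i → i < N → ∣ coeff p i ∣ ≡ 1) × (∀ i → N ≤ i → ∣ coeff p i ∣ ≡ 0)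

UnitCoeffsBelow-≋ : ∀ {p q N} → p ≋ q → UnitCoeffsBelow p N → UnitCoeffsBelow q N
UnitCoeffsBelow-≋ p≋q (low , high) =
  (λ i i<N → trans (cong ∣_∣ (sym (at p≋q i))) (low i i<N)) ,
  (λ i N≤i → trans (cong ∣_∣ (sym (at p≋q i))) (high i N≤i))

UnitCoeffsBelow-double : ∀ p N → UnitCoeffsBelow p N → UnitCoeffsBelow (xm1 *ₚ dilate p) (N + N)
UnitCoeffsBelow-double p N (low , high) =
  (λ j j<2N → trans (∣coeff-xm1*dilate∣ p j) (low ⌊ j /2⌋ (⌊j/2⌋<N j<2N))) ,
  (λ j 2N≤j → trans (∣coeff-xm1*dilate∣ p j) (high ⌊ j /2⌋ (N≤⌊j/2⌋ 2N≤j)))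

UnitCoeffsBelow-F : ∀ n → UnitCoeffsBelow (Fpoly n (powersOfTwo n)) (2 ^ n)
UnitCoeffsBelow-F zero    = (λ { zero _ → refl ; (suc i) (s≤s ()) }) , (λ { zero () ; (suc i) _ → refl })
UnitCoeffsBelow-F (suc n) =
  subst (UnitCoeffsBelow (Fpoly (suc n) (powersOfTwo (suc n)))) (cong (λ k → 2 ^ n + k) (sym (ℕP.+-identityʳ (2 ^ n))))
    (UnitCoeffsBelow-≋ (≋-sym (F-doubling n))
      (UnitCoeffsBelow-double (Fpoly n (powersOfTwo n)) (2 ^ n) (UnitCoeffsBelow-F n)))

height-lub : ∀ p h → (∀ i → ∣ coeff p i ∣ ≤ h) → height p ≤ h
height-lub []      h bound = z≤n
height-lub (a ∷ p) h bound = ℕP.⊔-lub (bound 0) (height-lub p h (λ i → bound (suc i)))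

coeff≤height : ∀ p i → ∣ coeff p i ∣ ≤ height p
coeff≤height []      i       = z≤n
coeff≤height (a ∷ p) zero    = ℕP.m≤m⊔n ∣ a ∣ (height p)
coeff≤height (a ∷ p) (suc i) = ℕP.≤-trans (coeff≤height p i) (ℕP.m≤n⊔m ∣ a ∣ (height p))

UnitCoeffsBelow⇒height-degree : ∀ p N → 1 ≤ N → UnitCoeffsBelow p N → height p ≡ 1 × HasDegree p (N ∸ 1)
UnitCoeffsBelow⇒height-degree p (suc M) _ (low , high) = height≡1 , leading≢0 , above≡0
  where
  ∣coeff∣≤1 : ∀ i → ∣ coeff p i ∣ ≤ 1
  ∣coeff∣≤1 i with i ℕ.<? suc M
  ... | yes i<N = ℕP.≤-reflexive (low i i<N)
  ... | no  i≮N = ℕP.≤-trans (ℕP.≤-reflexive (high i (ℕP.≮⇒≥ i≮N))) z≤n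
  height≡1 : height p ≡ 1
  height≡1 = ℕP.≤-antisym (height-lub p 1 ∣coeff∣≤1)
    (ℕP.≤-trans (ℕP.≤-reflexive (sym (low 0 (s≤s z≤n)))) (coeff≤height p 0))
  leading≢0 : ¬ coeff p M ≡ + 0
  leading≢0 pM≡0 with trans (sym (cong ∣_∣ pM≡0)) (low M ℕP.≤-refl)
  ... | ()
  above≡0 : ∀ i → M < i → coeff p i ≡ + 0
  above≡0 i M<i = ℤP.∣i∣≡0⇒i≡0 (high i M<i)

mainTheorem7 : (n : ℕ) → 1 ≤ n →
    ((e : Fin n → ℕ) → (∀ k → 1 ≤ e k) →
      (∃[ q ] (Fpoly n e ≈ₚ ((xm1 ^ₚ n) *ₚ q)))
      × (Fpoly n e ≈ₚ ((xm1 ^ₚ n) *ₚ Gpoly n e))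
      × (∏ n e ≤ height (Gpoly n e) * (1 + ∑ n (λ j → e j ∸ 1))))
    × (height (Fpoly n (λ k → 2 ^ toℕ k)) ≡ 1
       × HasDegree (Fpoly n (λ k → 2 ^ toℕ k)) (2 ^ n ∸ 1))
mainTheorem7 n _ =
  (λ e e≥1 →
    (Gpoly n e , at (F≋xm1^n*G n e)) , at (F≋xm1^n*G n e) , height-G-bound n e e≥1) ,
  UnitCoeffsBelow⇒height-degree (Fpoly n (powersOfTwo n)) (2 ^ n) (ℕP.m^n>0 2 n) (UnitCoeffsBelow-F n)
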